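{- Let $F=F_2$ be the free group on $s,t$, let $R\trianglelefteq F$ and $G=F/R$, let $N$ be a group with center $C$, and fix a prescribed action of $F$ on $N$. Let $X$ be the set of all maps $\varphi_E$ where $E$ ranges over extensions of $N$ by $G$ with the prescribed $F$-action on $N$. Then the group $\mathrm{Hom}_F(R,C)$ acts regularly on $X$ via $\varphi^\alpha(w(s,t))=\varphi(w(s,t))\,\alpha(w(s,t))$ for $\alpha\in\mathrm{Hom}_F(R,C)$, $\varphi\in X$.
   Context: An extension of $N$ by $G$ is a group $E$ containing $N$ as a normal subgroup together with an identification $E/N\cong G$. Choosing lifts $\hat s,\hat t\in E$ of $Rs,Rt$, each word $w(s,t)\in F$ acts on $N$ by conjugation with $w(\hat s,\hat t)$; $E$ has the prescribed $F$-action if this action coincides with the fixed action of $F$ on $N$. For such $E$, $\varphi_E:R\to N$ is defined by $w(s,t)\mapsto w(\hat s,\hat t)$. $\mathrm{Hom}_F(R,C)$ is the group (under pointwise multiplication) of homomorphisms $R\to C$ that are equivariant for the action of $F$ on $R$ by conjugation and the prescribed action of $F$ on $C$. An action is regular if it is transitive and all point stabilizers are trivial. -}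

module Defs where

open import Level using (Level; _⊔_; suc; 0ℓ)
open import Data.Fin using (Fin)
open import Data.Product using (Σ; Σ-syntax; ∃; ∃-syntax; _×_; _,_)
open import Function.Bundles using (_⇔_)
open import Algebra.Bundles using (Group)
open import Algebra.Morphism.Structures using (module GroupMorphisms)

-- The free group F = F₂ on generators s = gen 0, t = gen 1,
-- presented as group words modulo the congruence generated by the
-- group axioms (the free group as a setoid).

infixl 7 _·_

data Word : Set where
  gen : Fin 2 → Word
  1w  : Word
  _·_ : Word → Word → Word
  inv : Word → Word

infix 4 _~_

data _~_ : Word → Word → Set where
  ~-refl  : ∀ {u} → u ~ u
  ~-sym   : ∀ {u v} → u ~ v → v ~ u
  ~-trans : ∀ {u v w} → u ~ v → v ~ w → u ~ w
  ·-cong  : ∀ {u u' v v'} → u ~ u' → v ~ v' → u · v ~ u' · v'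
  inv-cong : ∀ {u v} → u ~ v → inv u ~ inv v
  ·-assoc : ∀ u v w → (u · v) · w ~ u · (v · w)
  ·-idˡ   : ∀ u → 1w · u ~ u
  ·-idʳ   : ∀ u → u · 1w ~ u
  inv-ˡ   : ∀ u → inv u · u ~ 1w
  inv-ʳ   : ∀ u → u · inv u ~ 1w

module _ {c ℓ} (E : Group c ℓ) where
  open Group E
  eval : Word → (Fin 2 → Carrier) → Carrier
  eval (gen i) x = x i
  eval 1w      x = ε
  eval (u · v) x = eval u x ∙ eval v x
  eval (inv u) x = eval u x ⁻¹

record NormalSubgroup : Set₁ where
  field
    R        : Word → Set
    R-resp   : ∀ {u v} → u ~ v → R u → R v
    R-1      : R 1w
    R-mul    : ∀ {u v} → R u → R v → R (u · v)
    R-inv    : ∀ {u} → R u → R (inv u)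
    R-conj   : ∀ w {r} → R r → R ((w · r) · inv w)

  -- equality in G = F/R
  infix 4 _≡R_
  _≡R_ : Word → Word → Set
  u ≡R v = R (inv u · v)

record FAction {c ℓ} (N : Group c ℓ) : Set (c ⊔ ℓ) where
  open Group N
  field
    act      : Word → Carrier → Carrier
    act-cong : ∀ {u v x y} → u ~ v → x ≈ y → act u x ≈ act v y
    act-∙    : ∀ w x y → act w (x ∙ y) ≈ act w x ∙ act w y
    act-1    : ∀ x → act 1w x ≈ x
    act-·    : ∀ u v x → act (u · v) x ≈ act u (act v x)

module _ {c ℓ} (N : Group c ℓ) (RR : NormalSubgroup) (A : FAction N) where
  open NormalSubgroup RR
  open FAction A
  private module N = Group N

  RMap : Set c
  RMap = (r : Word) → R r → N.Carrier

  _≈R_ : RMap → RMap → Set ℓ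
  φ ≈R ψ = ∀ r (p : R r) → φ r p N.≈ ψ r p

  _⋆_ : RMap → RMap → RMap
  (φ ⋆ α) r p = φ r p N.∙ α r p

  -- Extension data: E a group, ι : N ↪ E, π : E ↠ F/R with ker π = im ι,
  -- lifts ŝ , t̂ (= lift 0 , lift 1) of Rs , Rt, and the prescribed
  -- F-action on N is given by conjugation with w(ŝ,t̂).
  record IsExtension (E : Group c ℓ) (ι : N.Carrier → Group.Carrier E)
                     (π : Group.Carrier E → Word)
                     (lift : Fin 2 → Group.Carrier E) : Set (c ⊔ ℓ) where
    private module E = Group E
    open GroupMorphisms N.rawGroup E.rawGroup
    field
      ι-mono      : IsGroupMonomorphism ι
      π-cong      : ∀ {x y} → x E.≈ y → π x ≡R π y
      π-hom       : ∀ x y → π (x E.∙ y) ≡R π x · π y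
      π-surj      : ∀ w → ∃[ x ] (π x ≡R w)
      exact       : ∀ x → (π x ≡R 1w) ⇔ (∃[ n ] (ι n E.≈ x))
      lift-ok     : ∀ i → π (lift i) ≡R gen i
      prescribed  : ∀ w n →
        (eval E w lift E.∙ ι n) E.∙ (eval E w lift) E.⁻¹ E.≈ ι (act w n)

  -- φ ∈ X : φ = φ_E for some extension E (with some choice of lifts);
  -- φ_E(r) is the element of N with ι(φ_E r) = r(ŝ,t̂).
  InX : RMap → Set (suc (c ⊔ ℓ))
  InX φ = Σ[ E ∈ Group c ℓ ] Σ[ ι ∈ (N.Carrier → Group.Carrier E) ]
          Σ[ π ∈ (Group.Carrier E → Word) ] Σ[ lift ∈ (Fin 2 → Group.Carrier E) ]
          (IsExtension E ι π lift ×
           (∀ r (p : R r) → Group._≈_ E (ι (φ r p)) (eval E r lift)))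

  record HomF : Set (c ⊔ ℓ) where
    field
      α         : RMap
      α-resp    : ∀ {r r'} (p : R r) (p' : R r') → r ~ r' → α r p N.≈ α r' p'
      α-hom     : ∀ {r r'} (p : R r) (p' : R r') → α (r · r') (R-mul p p') N.≈ α r p N.∙ α r' p'
      α-central : ∀ r (p : R r) y → α r p N.∙ y N.≈ y N.∙ α r p
      α-equiv   : ∀ w {r} (p : R r) → α ((w · r) · inv w) (R-conj w p) N.≈ act w (α r p)

  1R : RMap
  1R r p = N.ε

module Submission where

-- Call θ : R → N *admissible* if it respects the word congruence, is
-- multiplicative, is F-equivariant, and realises the prescribed action of
-- every relator by an inner automorphism: act r n = θ(r) n θ(r)⁻¹.  The core
-- of the file is the characterisation  X = { admissible maps }.
--   * Every φ_E is admissible (inX⇒admissible): ι is injective and r(ŝ,t̂)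
--     conjugates ι(N) as prescribed.
--   * Every admissible θ equals some φ_E (admissible⇒inX): divide the
--     semidirect product N ⋊ F by the normal subgroup
--     K_θ = {(n , r) | r ∈ R, n θ(r) = 1}; with lifts (1 , s), (1 , t) the
--     quotient is an extension of N by F/R whose φ_E is θ.
-- The theorem then reduces to elementary group theory: twisting an admissible
-- map by a central equivariant homomorphism keeps it admissible; φ ⋆ α = φ
-- forces α = 1 by cancellation; and for admissible φ, ψ the pointwise quotient
-- φ⁻¹ψ is central (φ(r) and ψ(r) induce the same inner automorphism), hence
-- lies in Hom_F(R, C).

open import Defs
open import Level using (_⊔_; 0ℓ)
open import Data.Fin using (Fin)
open import Data.Product using (Σ; Σ-syntax; ∃-syntax; _×_; _,_; proj₁; proj₂)
open import Function.Bundles using (mk⇔)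
open import Algebra.Bundles using (Group)
open import Algebra.Morphism.Structures using (module GroupMorphisms)
import Algebra.Properties.Group as GroupProperties
import Relation.Binary.Reasoning.Setoid as SetoidReasoning

module GroupFacts {c ℓ} (G : Group c ℓ) where
  open Group G public
  open GroupProperties G public
  open SetoidReasoning setoid public

  Central : Carrier → Set (c ⊔ ℓ)
  Central z = ∀ y → z ∙ y ≈ y ∙ z

  interchange : ∀ {z} → Central z → ∀ x x' z' → (x ∙ x') ∙ (z ∙ z') ≈ (x ∙ z) ∙ (x' ∙ z')
  interchange {z} central x x' z' = begin
    (x ∙ x') ∙ (z ∙ z')  ≈⟨ assoc x x' (z ∙ z') ⟩
    x ∙ (x' ∙ (z ∙ z'))  ≈⟨ ∙-congˡ (assoc x' z z') ⟨
    x ∙ ((x' ∙ z) ∙ z')  ≈⟨ ∙-congˡ (∙-congʳ (central x')) ⟨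
    x ∙ ((z ∙ x') ∙ z')  ≈⟨ ∙-congˡ (assoc z x' z') ⟩
    x ∙ (z ∙ (x' ∙ z'))  ≈⟨ assoc x z (x' ∙ z') ⟨
    (x ∙ z) ∙ (x' ∙ z')  ∎

  conj-central : ∀ {z} → Central z → ∀ x n → ((x ∙ z) ∙ n) ∙ (x ∙ z) ⁻¹ ≈ (x ∙ n) ∙ x ⁻¹
  conj-central {z} central x n = begin
    ((x ∙ z) ∙ n) ∙ (x ∙ z) ⁻¹     ≈⟨ ∙-cong xzn≈xnz (⁻¹-anti-homo-∙ x z) ⟩
    ((x ∙ n) ∙ z) ∙ (z ⁻¹ ∙ x ⁻¹)  ≈⟨ assoc ((x ∙ n) ∙ z) (z ⁻¹) (x ⁻¹) ⟨
    (((x ∙ n) ∙ z) ∙ z ⁻¹) ∙ x ⁻¹  ≈⟨ ∙-congʳ (//-rightDividesʳ z (x ∙ n)) ⟩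
    (x ∙ n) ∙ x ⁻¹                 ∎
    where
    xzn≈xnz : (x ∙ z) ∙ n ≈ (x ∙ n) ∙ z
    xzn≈xnz = trans (assoc x z n) (trans (∙-congˡ (central n)) (sym (assoc x n z)))

  same-conj⇒central : ∀ x y → (∀ n → (x ∙ n) ∙ x ⁻¹ ≈ (y ∙ n) ∙ y ⁻¹) → Central (x ⁻¹ ∙ y)
  same-conj⇒central x y same n = begin
    (x ⁻¹ ∙ y) ∙ n                 ≈⟨ assoc (x ⁻¹) y n ⟩
    x ⁻¹ ∙ (y ∙ n)                 ≈⟨ ∙-congˡ (//-rightDividesˡ y (y ∙ n)) ⟨
    x ⁻¹ ∙ (((y ∙ n) ∙ y ⁻¹) ∙ y)  ≈⟨ ∙-congˡ (∙-congʳ (same n)) ⟨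
    x ⁻¹ ∙ (((x ∙ n) ∙ x ⁻¹) ∙ y)  ≈⟨ ∙-congˡ (assoc (x ∙ n) (x ⁻¹) y) ⟩
    x ⁻¹ ∙ ((x ∙ n) ∙ (x ⁻¹ ∙ y))  ≈⟨ assoc (x ⁻¹) (x ∙ n) (x ⁻¹ ∙ y) ⟨
    (x ⁻¹ ∙ (x ∙ n)) ∙ (x ⁻¹ ∙ y)  ≈⟨ ∙-congʳ (\\-leftDividesʳ x n) ⟩
    n ∙ (x ⁻¹ ∙ y)                 ∎

record IsNormalSubgroup {c ℓ k} (G : Group c ℓ) (K : Group.Carrier G → Set k) : Set (c ⊔ ℓ ⊔ k) where
  open Group G
  field
    K-resp : ∀ {x y} → x ≈ y → K x → K y
    K-ε    : K ε
    K-∙    : ∀ {x y} → K x → K y → K (x ∙ y)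
    K-⁻¹   : ∀ {x} → K x → K (x ⁻¹)
    K-conj : ∀ g {k} → K k → K ((g ∙ k) ∙ g ⁻¹)

module Quotient {c ℓ k} (G : Group c ℓ) {K : Group.Carrier G → Set k}
                (normal : IsNormalSubgroup G K) where
  open GroupFacts G
  open IsNormalSubgroup normal

  infix 4 _≈K_
  _≈K_ : Carrier → Carrier → Set k
  x ≈K y = K (x ⁻¹ ∙ y)

  ≈⇒≈K : ∀ {x y} → x ≈ y → x ≈K y
  ≈⇒≈K {x} {y} x≈y = K-resp (sym (trans (∙-congʳ (⁻¹-cong x≈y)) (inverseˡ y))) K-ε

  ≈K-sym : ∀ {x y} → x ≈K y → y ≈K x
  ≈K-sym {x} {y} x≈y = K-resp (⁻¹-anti-homo-\\ x y) (K-⁻¹ x≈y)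

  ≈K-trans : ∀ {x y z} → x ≈K y → y ≈K z → x ≈K z
  ≈K-trans {x} {y} {z} x≈y y≈z = K-resp x⁻¹y∙y⁻¹z≈x⁻¹z (K-∙ x≈y y≈z)
    where
    x⁻¹y∙y⁻¹z≈x⁻¹z : (x ⁻¹ ∙ y) ∙ (y ⁻¹ ∙ z) ≈ x ⁻¹ ∙ z
    x⁻¹y∙y⁻¹z≈x⁻¹z = trans (assoc (x ⁻¹) y _) (∙-congˡ (\\-leftDividesˡ y z))

  -- (xy)⁻¹(x'y') is a conjugate of x⁻¹x' (by y⁻¹) times y⁻¹y'
  ∙-congK : ∀ {x x' y y'} → x ≈K x' → y ≈K y' → (x ∙ y) ≈K (x' ∙ y')
  ∙-congK {x} {x'} {y} {y'} x≈x' y≈y' = K-resp eq (K-∙ (K-conj (y ⁻¹) x≈x') y≈y')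
    where
    eq : ((y ⁻¹ ∙ (x ⁻¹ ∙ x')) ∙ y ⁻¹ ⁻¹) ∙ (y ⁻¹ ∙ y') ≈ (x ∙ y) ⁻¹ ∙ (x' ∙ y')
    eq = begin
      ((y ⁻¹ ∙ (x ⁻¹ ∙ x')) ∙ y ⁻¹ ⁻¹) ∙ (y ⁻¹ ∙ y') ≈⟨ assoc _ _ _ ⟩
      (y ⁻¹ ∙ (x ⁻¹ ∙ x')) ∙ (y ⁻¹ ⁻¹ ∙ (y ⁻¹ ∙ y')) ≈⟨ ∙-congˡ (\\-leftDividesʳ (y ⁻¹) y') ⟩
      (y ⁻¹ ∙ (x ⁻¹ ∙ x')) ∙ y'                       ≈⟨ assoc _ _ _ ⟩
      y ⁻¹ ∙ ((x ⁻¹ ∙ x') ∙ y')                       ≈⟨ ∙-congˡ (assoc _ _ _) ⟩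
      y ⁻¹ ∙ (x ⁻¹ ∙ (x' ∙ y'))                       ≈⟨ assoc _ _ _ ⟨
      (y ⁻¹ ∙ x ⁻¹) ∙ (x' ∙ y')                       ≈⟨ ∙-congʳ (⁻¹-anti-homo-∙ x y) ⟨
      (x ∙ y) ⁻¹ ∙ (x' ∙ y')                          ∎

  -- x⁻¹⁻¹ y⁻¹ = x y⁻¹ is the conjugate of y⁻¹x by x
  ⁻¹-congK : ∀ {x y} → x ≈K y → (x ⁻¹) ≈K (y ⁻¹)
  ⁻¹-congK {x} {y} x≈y = K-resp eq (K-conj x (≈K-sym x≈y))
    where
    eq : (x ∙ (y ⁻¹ ∙ x)) ∙ x ⁻¹ ≈ x ⁻¹ ⁻¹ ∙ y ⁻¹
    eq = begin
      (x ∙ (y ⁻¹ ∙ x)) ∙ x ⁻¹  ≈⟨ assoc _ _ _ ⟩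
      x ∙ ((y ⁻¹ ∙ x) ∙ x ⁻¹)  ≈⟨ ∙-congˡ (//-rightDividesʳ x (y ⁻¹)) ⟩
      x ∙ y ⁻¹                 ≈⟨ ∙-congʳ (⁻¹-involutive x) ⟨
      x ⁻¹ ⁻¹ ∙ y ⁻¹           ∎

  G/K : Group c k
  G/K = record
    { Carrier = Carrier ; _≈_ = _≈K_ ; _∙_ = _∙_ ; ε = ε ; _⁻¹ = _⁻¹
    ; isGroup = record
      { isMonoid = record
        { isSemigroup = record
          { isMagma = record
            { isEquivalence = record { refl = ≈⇒≈K refl ; sym = ≈K-sym ; trans = ≈K-trans }
            ; ∙-cong = ∙-congK }
          ; assoc = λ x y z → ≈⇒≈K (assoc x y z) }
        ; identity = (λ x → ≈⇒≈K (identityˡ x)) , (λ x → ≈⇒≈K (identityʳ x)) }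
      ; inverse = (λ x → ≈⇒≈K (inverseˡ x)) , (λ x → ≈⇒≈K (inverseʳ x))
      ; ⁻¹-cong = ⁻¹-congK } }

FreeGroup : Group 0ℓ 0ℓ
FreeGroup = record
  { Carrier = Word ; _≈_ = _~_ ; _∙_ = _·_ ; ε = 1w ; _⁻¹ = inv
  ; isGroup = record
    { isMonoid = record
      { isSemigroup = record
        { isMagma = record
          { isEquivalence = record { refl = ~-refl ; sym = ~-sym ; trans = ~-trans }
          ; ∙-cong = ·-cong }
        ; assoc = ·-assoc }
      ; identity = ·-idˡ , ·-idʳ }
    ; inverse = inv-ˡ , inv-ʳ
    ; ⁻¹-cong = inv-cong } }

module F = GroupProperties FreeGroup

eval-cong : ∀ {c ℓ} (E : Group c ℓ) (x : Fin 2 → Group.Carrier E) {u v} →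
            u ~ v → Group._≈_ E (eval E u x) (eval E v x)
eval-cong E x ~-refl          = Group.refl E
eval-cong E x (~-sym p)       = Group.sym E (eval-cong E x p)
eval-cong E x (~-trans p q)   = Group.trans E (eval-cong E x p) (eval-cong E x q)
eval-cong E x (·-cong p q)    = Group.∙-cong E (eval-cong E x p) (eval-cong E x q)
eval-cong E x (inv-cong p)    = Group.⁻¹-cong E (eval-cong E x p)
eval-cong E x (·-assoc u v w) = Group.assoc E _ _ _
eval-cong E x (·-idˡ u)       = Group.identityˡ E _
eval-cong E x (·-idʳ u)       = Group.identityʳ E _
eval-cong E x (inv-ˡ u)       = Group.inverseˡ E _
eval-cong E x (inv-ʳ u)       = Group.inverseʳ E _

module ActionFacts {c ℓ} {N : Group c ℓ} (A : FAction N) where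
  open GroupFacts N
  open FAction A

  act-congʳ : ∀ w {x y} → x ≈ y → act w x ≈ act w y
  act-congʳ w = act-cong ~-refl

  act-ε : ∀ w → act w ε ≈ ε
  act-ε w = identityʳ-unique (act w ε) (act w ε)
              (trans (sym (act-∙ w ε ε)) (act-congʳ w (identityˡ ε)))

  act-⁻¹ : ∀ w x → act w (x ⁻¹) ≈ act w x ⁻¹
  act-⁻¹ w x = inverseˡ-unique _ _
    (trans (sym (act-∙ w (x ⁻¹) x)) (trans (act-congʳ w (inverseˡ x)) (act-ε w)))

  act-inv-1w : ∀ x → act (inv 1w) x ≈ x
  act-inv-1w x = trans (act-cong F.ε⁻¹≈ε refl) (act-1 x)

  act-inv-cancel : ∀ w x → act w (act (inv w) x) ≈ x
  act-inv-cancel w x = trans (sym (act-· w (inv w) x)) (trans (act-cong (inv-ʳ w) refl) (act-1 x))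

module SemidirectProduct {c ℓ} {N : Group c ℓ} (A : FAction N) where
  open GroupFacts N
  open FAction A
  open ActionFacts A

  Pair : Set c
  Pair = Carrier × Word

  _≈ₛ_ : Pair → Pair → Set ℓ
  (m , v) ≈ₛ (m' , v') = (m ≈ m') × (v ~ v')

  _∙ₛ_ : Pair → Pair → Pair
  (m , v) ∙ₛ (m' , v') = (m ∙ act v m') , (v · v')

  _⁻¹ₛ : Pair → Pair
  (m , v) ⁻¹ₛ = act (inv v) (m ⁻¹) , inv v

  ∙ₛ-assoc : ∀ x y z → ((x ∙ₛ y) ∙ₛ z) ≈ₛ (x ∙ₛ (y ∙ₛ z))
  ∙ₛ-assoc (m , v) (m' , v') (m'' , v'') = (begin
    (m ∙ act v m') ∙ act (v · v') m''        ≈⟨ assoc _ _ _ ⟩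
    m ∙ (act v m' ∙ act (v · v') m'')        ≈⟨ ∙-congˡ (∙-congˡ (act-· v v' m'')) ⟩
    m ∙ (act v m' ∙ act v (act v' m''))      ≈⟨ ∙-congˡ (act-∙ v _ _) ⟨
    m ∙ act v (m' ∙ act v' m'')              ∎) , ·-assoc v v' v''

  N⋊F : Group c ℓ
  N⋊F = record
    { Carrier = Pair ; _≈_ = _≈ₛ_ ; _∙_ = _∙ₛ_ ; ε = ε , 1w ; _⁻¹ = _⁻¹ₛ
    ; isGroup = record
      { isMonoid = record
        { isSemigroup = record
          { isMagma = record
            { isEquivalence = record
              { refl = refl , ~-refl
              ; sym = λ (m≈ , v~) → sym m≈ , ~-sym v~
              ; trans = λ (m≈ , v~) (m≈' , v~') → trans m≈ m≈' , ~-trans v~ v~' }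
            ; ∙-cong = λ (m≈ , v~) (m≈' , v~') → ∙-cong m≈ (act-cong v~ m≈') , ·-cong v~ v~' }
          ; assoc = ∙ₛ-assoc }
        ; identity = (λ _ → trans (identityˡ _) (act-1 _) , ·-idˡ _)
                   , (λ (m , v) → trans (∙-congˡ (act-ε v)) (identityʳ m) , ·-idʳ v) }
      ; inverse = (λ (m , v) → trans (sym (act-∙ (inv v) _ _))
                                 (trans (act-congʳ (inv v) (inverseˡ m)) (act-ε (inv v))) , inv-ˡ v)
                , (λ (m , v) → trans (∙-congˡ (act-inv-cancel v _)) (inverseʳ m) , inv-ʳ v)
      ; ⁻¹-cong = λ (m≈ , v~) → act-cong (inv-cong v~) (⁻¹-cong m≈) , inv-cong v~ } }

module Extensions {c ℓ} (N : Group c ℓ) (RR : NormalSubgroup) (A : FAction N) where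
  open NormalSubgroup RR
  open FAction A
  open GroupFacts N
  open ActionFacts A

  ~⇒≡R : ∀ {u v} → u ~ v → u ≡R v
  ~⇒≡R {u} u~v = R-resp (~-trans (~-sym (inv-ˡ u)) (·-cong ~-refl u~v)) R-1

  ≡R-sym : ∀ {u v} → u ≡R v → v ≡R u
  ≡R-sym {u} {v} u≡v = R-resp (~-trans (F.⁻¹-anti-homo-∙ (inv u) v) (·-cong ~-refl (F.⁻¹-involutive u)))
                              (R-inv u≡v)

  record Admissible (θ : RMap N RR A) : Set (c ⊔ ℓ) where
    field
      resp  : ∀ {r r'} (p : R r) (p' : R r') → r ~ r' → θ r p ≈ θ r' p'
      hom   : ∀ {r r'} (p : R r) (p' : R r') (q : R (r · r')) → θ (r · r') q ≈ θ r p ∙ θ r' p'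
      equiv : ∀ w {r} (p : R r) → θ ((w · r) · inv w) (R-conj w p) ≈ act w (θ r p)
      inner : ∀ {r} (p : R r) n → act r n ≈ (θ r p ∙ n) ∙ θ r p ⁻¹

    θ-trivial : ∀ {r} (p : R r) → r ~ 1w → θ r p ≈ ε
    θ-trivial p r~1 = trans (resp p R-1 r~1)
      (identityʳ-unique _ _ (trans (sym (hom R-1 R-1 q)) (resp q R-1 (·-idˡ 1w))))
      where q = R-mul R-1 R-1

    θ-inv : ∀ {v} (p : R v) (p' : R (inv v)) → θ (inv v) p' ≈ θ v p ⁻¹
    θ-inv {v} p p' = inverseˡ-unique _ _ (trans (sym (hom p' p q)) (θ-trivial q (inv-ˡ v)))
      where q = R-mul p' p

  open Admissible

  -- Every φ_E is admissible: transport each property of r ↦ r(ŝ,t̂) ∈ E back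
  -- to N along the injective homomorphism ι.
  inX⇒admissible : ∀ {φ} → InX N RR A φ → Admissible φ
  inX⇒admissible {φ} (E , ι , π , lift , ext , ιφ≈eval) = record
    { resp  = λ {r} {r'} p p' r~r' → injective
        (E.trans (ιφ≈eval r p) (E.trans (eval-cong E lift r~r') (E.sym (ιφ≈eval r' p'))))
    ; hom   = λ {r} {r'} p p' q → injective
        (E.trans (ιφ≈eval _ q) (E.trans (E.∙-cong (E.sym (ιφ≈eval r p)) (E.sym (ιφ≈eval r' p')))
                                        (E.sym (∙-homo _ _))))
    ; equiv = λ w {r} p → injective
        (E.trans (ιφ≈eval _ _) (E.trans (E.∙-congʳ (E.∙-congˡ (E.sym (ιφ≈eval r p))))
                                        (prescribed w (φ r p))))
    ; inner = λ {r} p n → injective (E.begin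
        ι (act r n)                                  E.≈⟨ prescribed r n ⟨
        (eval E r lift E.∙ ι n) E.∙ eval E r lift E.⁻¹
          E.≈⟨ E.∙-cong (E.∙-congʳ (E.sym (ιφ≈eval r p))) (E.⁻¹-cong (E.sym (ιφ≈eval r p))) ⟩
        (ι (φ r p) E.∙ ι n) E.∙ ι (φ r p) E.⁻¹       E.≈⟨ E.∙-cong (∙-homo _ _) (⁻¹-homo _) ⟨
        ι (φ r p ∙ n) E.∙ ι (φ r p ⁻¹)               E.≈⟨ ∙-homo _ _ ⟨
        ι ((φ r p ∙ n) ∙ φ r p ⁻¹)                   E.∎)
    }
    where
    module E = GroupFacts E
    open IsExtension ext
    open GroupMorphisms (Group.rawGroup N) (Group.rawGroup E)
    open IsGroupMonomorphism ι-mono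

  -- Twisting by α ∈ Hom_F(R, C) preserves admissibility: α is multiplicative
  -- and equivariant, and being central it does not change inner automorphisms.
  twist-admissible : ∀ {φ} (h : HomF N RR A) → Admissible φ → Admissible (_⋆_ N RR A φ (HomF.α h))
  twist-admissible {φ} h adm = record
    { resp  = λ p p' r~r' → ∙-cong (resp adm p p' r~r') (α-resp p p' r~r')
    ; hom   = λ {r} {r'} p p' q →
        trans (∙-cong (hom adm p p' q) (trans (α-resp q (R-mul p p') ~-refl) (α-hom p p')))
              (interchange (α-central r p) _ _ _)
    ; equiv = λ w p → trans (∙-cong (equiv adm w p) (α-equiv w p)) (sym (act-∙ w _ _))
    ; inner = λ {r} p n → trans (inner adm p n) (sym (conj-central (α-central r p) (φ r p) n))
    }
    where open HomF h

  -- The pointwise quotient φ⁻¹ψ of two admissible maps lies in Hom_F(R, C):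
  -- it is central because φ(r) and ψ(r) induce the same automorphism act r.
  difference : ∀ {φ ψ} → Admissible φ → Admissible ψ → HomF N RR A
  difference {φ} {ψ} adφ adψ = record
    { α         = δ
    ; α-resp    = λ p p' r~r' → ∙-cong (⁻¹-cong (resp adφ p p' r~r')) (resp adψ p p' r~r')
    ; α-hom     = δ-hom
    ; α-central = λ r p → δ-central p
    ; α-equiv   = λ w {r} p → begin
        δ _ (R-conj w p)                    ≈⟨ ∙-cong (⁻¹-cong (equiv adφ w p)) (equiv adψ w p) ⟩
        act w (φ r p) ⁻¹ ∙ act w (ψ r p)    ≈⟨ ∙-congʳ (act-⁻¹ w _) ⟨
        act w (φ r p ⁻¹) ∙ act w (ψ r p)    ≈⟨ act-∙ w _ _ ⟨
        act w (δ r p)                       ∎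
    }
    where
    δ : RMap N RR A
    δ r p = φ r p ⁻¹ ∙ ψ r p

    δ-central : ∀ {r} (p : R r) → Central (δ r p)
    δ-central {r} p = same-conj⇒central (φ r p) (ψ r p)
                        (λ n → trans (sym (inner adφ p n)) (inner adψ p n))

    -- ψ = φ δ pointwise, so ψ(rr') = φ(r)φ(r')δ(r)δ(r') by centrality
    δ-hom : ∀ {r r'} (p : R r) (p' : R r') → δ (r · r') (R-mul p p') ≈ δ r p ∙ δ r' p'
    δ-hom {r} {r'} p p' = begin
      δ (r · r') q                                   ≈⟨ \\-cong₂ (hom adφ p p' q) (hom adψ p p' q) ⟩
      (φ r p ∙ φ r' p') ⁻¹ ∙ (ψ r p ∙ ψ r' p')       ≈⟨ y≈x\\z _ _ _ split ⟨
      δ r p ∙ δ r' p'                                ∎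
      where
      q = R-mul p p'
      split : (φ r p ∙ φ r' p') ∙ (δ r p ∙ δ r' p') ≈ ψ r p ∙ ψ r' p'
      split = trans (interchange (δ-central p) _ _ _)
                    (∙-cong (\\-leftDividesˡ _ _) (\\-leftDividesˡ _ _))

  -- Every admissible θ is φ_E for E = (N ⋊ F) / K_θ.
  module Realisation (θ : RMap N RR A) (adm : Admissible θ) where
    open SemidirectProduct A

    Kθ : Pair → Set ℓ
    Kθ (m , v) = Σ (R v) (λ p → m ∙ θ v p ≈ ε)

    -- K_θ is a normal subgroup of N ⋊ F: closure under products uses that r
    -- acts as conjugation by θ(r) and that θ is multiplicative
    Kθ-resp : ∀ {x y} → x ≈ₛ y → Kθ x → Kθ y
    Kθ-resp (m≈ , v~) (p , e) = R-resp v~ p , trans (∙-cong (sym m≈) (resp adm _ p (~-sym v~))) e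

    Kθ-∙ : ∀ {x y} → Kθ x → Kθ y → Kθ (x ∙ₛ y)
    Kθ-∙ {m , v} {m' , v'} (p , e) (p' , e') = R-mul p p' , (begin
      (m ∙ act v m') ∙ θ (v · v') (R-mul p p') ≈⟨ ∙-cong (∙-congˡ (inner adm p m')) (hom adm p p' _) ⟩
      (m ∙ ((a ∙ m') ∙ a ⁻¹)) ∙ (a ∙ b)         ≈⟨ assoc _ _ _ ⟩
      m ∙ (((a ∙ m') ∙ a ⁻¹) ∙ (a ∙ b))         ≈⟨ ∙-congˡ (assoc _ _ _) ⟩
      m ∙ ((a ∙ m') ∙ (a ⁻¹ ∙ (a ∙ b)))         ≈⟨ ∙-congˡ (∙-congˡ (\\-leftDividesʳ a b)) ⟩
      m ∙ ((a ∙ m') ∙ b)                        ≈⟨ ∙-congˡ (assoc _ _ _) ⟩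
      m ∙ (a ∙ (m' ∙ b))                        ≈⟨ assoc _ _ _ ⟨
      (m ∙ a) ∙ (m' ∙ b)                        ≈⟨ ∙-cong e e' ⟩
      ε ∙ ε                                     ≈⟨ identityˡ ε ⟩
      ε                                         ∎)
      where
      a = θ v p
      b = θ v' p'

    -- (m , v)⁻¹ = (v⁻¹(m⁻¹) , v⁻¹), and θ(v⁻¹) = θ(v)⁻¹
    Kθ-⁻¹ : ∀ {x} → Kθ x → Kθ (x ⁻¹ₛ)
    Kθ-⁻¹ {m , v} (p , e) = R-inv p , (begin
      act (inv v) (m ⁻¹) ∙ b        ≈⟨ ∙-congʳ (inner adm (R-inv p) (m ⁻¹)) ⟩
      ((b ∙ m ⁻¹) ∙ b ⁻¹) ∙ b       ≈⟨ //-rightDividesˡ b (b ∙ m ⁻¹) ⟩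
      b ∙ m ⁻¹                      ≈⟨ ∙-congʳ (θ-inv adm p (R-inv p)) ⟩
      θ v p ⁻¹ ∙ m ⁻¹               ≈⟨ ⁻¹-anti-homo-∙ m (θ v p) ⟨
      (m ∙ θ v p) ⁻¹                ≈⟨ ⁻¹-cong e ⟩
      ε ⁻¹                          ≈⟨ ε⁻¹≈ε ⟩
      ε                             ∎)
      where
      b = θ (inv v) (R-inv p)

    -- conjugating (m , v) ∈ K_θ by (n , w) gives the relator w v w⁻¹, whose
    -- θ-value is w(θ(v)) by equivariance
    Kθ-conj : ∀ g {k} → Kθ k → Kθ ((g ∙ₛ k) ∙ₛ (g ⁻¹ₛ))
    Kθ-conj (n , w) {m , v} (p , e) = R-conj w p , (begin
      ((n ∙ act w m) ∙ act (w · v) x) ∙ θ ((w · v) · inv w) (R-conj w p)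
                                           ≈⟨ ∙-cong (∙-congˡ act-wv-x) (equiv adm w p) ⟩
      ((n ∙ act w m) ∙ ((a' ∙ n ⁻¹) ∙ a' ⁻¹)) ∙ a' ≈⟨ assoc _ _ _ ⟩
      (n ∙ act w m) ∙ (((a' ∙ n ⁻¹) ∙ a' ⁻¹) ∙ a') ≈⟨ ∙-congˡ (//-rightDividesˡ a' _) ⟩
      (n ∙ act w m) ∙ (a' ∙ n ⁻¹)          ≈⟨ assoc _ _ _ ⟩
      n ∙ (act w m ∙ (a' ∙ n ⁻¹))          ≈⟨ ∙-congˡ (assoc _ _ _) ⟨
      n ∙ ((act w m ∙ a') ∙ n ⁻¹)          ≈⟨ ∙-congˡ (∙-congʳ (act-∙ w m a)) ⟨
      n ∙ (act w (m ∙ a) ∙ n ⁻¹)           ≈⟨ ∙-congˡ (∙-congʳ (trans (act-congʳ w e) (act-ε w))) ⟩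
      n ∙ (ε ∙ n ⁻¹)                       ≈⟨ ∙-congˡ (identityˡ _) ⟩
      n ∙ n ⁻¹                             ≈⟨ inverseʳ n ⟩
      ε                                    ∎)
      where
      a = θ v p
      a' = act w a
      x = act (inv w) (n ⁻¹)
      act-wv-x : act (w · v) x ≈ (a' ∙ n ⁻¹) ∙ a' ⁻¹
      act-wv-x = begin
        act (w · v) x                   ≈⟨ act-· w v x ⟩
        act w (act v x)                 ≈⟨ act-congʳ w (inner adm p x) ⟩
        act w ((a ∙ x) ∙ a ⁻¹)          ≈⟨ act-∙ w _ _ ⟩
        act w (a ∙ x) ∙ act w (a ⁻¹)    ≈⟨ ∙-cong (act-∙ w _ _) (act-⁻¹ w a) ⟩
        (a' ∙ act w x) ∙ a' ⁻¹          ≈⟨ ∙-congʳ (∙-congˡ (act-inv-cancel w _)) ⟩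
        (a' ∙ n ⁻¹) ∙ a' ⁻¹             ∎

    Kθ-normal : IsNormalSubgroup N⋊F Kθ
    Kθ-normal = record
      { K-resp = Kθ-resp
      ; K-ε    = R-1 , trans (identityˡ _) (θ-trivial adm R-1 ~-refl)
      ; K-∙    = Kθ-∙
      ; K-⁻¹   = Kθ-⁻¹
      ; K-conj = Kθ-conj }

    open Quotient N⋊F Kθ-normal
    module E = Group G/K

    ι : Carrier → Pair
    ι n = n , 1w

    π : Pair → Word
    π = proj₂

    lift : Fin 2 → Pair
    lift i = ε , gen i

    eval-lift : ∀ w → eval G/K w lift E.≈ (ε , w)
    eval-lift (gen i) = E.refl
    eval-lift 1w      = E.refl
    eval-lift (u · v) = E.trans (E.∙-cong (eval-lift u) (eval-lift v))
                                (≈⇒≈K (trans (identityˡ _) (act-ε u) , ~-refl))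
    eval-lift (inv u) = E.trans (E.⁻¹-cong (eval-lift u))
                                (≈⇒≈K (trans (act-congʳ _ ε⁻¹≈ε) (act-ε _) , ~-refl))

    -- the second coordinate of (n , 1)⁻¹ (m , r) is inv 1w · r
    inv1w·r~r : ∀ r → inv 1w · r ~ r
    inv1w·r~r r = ~-trans (·-cong F.ε⁻¹≈ε ~-refl) (·-idˡ r)

    -- (n , 1) ≡ (1 , r) modulo K_θ when n = θ(r), since (n , 1)⁻¹ (1 , r) = (n⁻¹ , r)
    ι-realises : ∀ r (p : R r) → ι (θ r p) E.≈ (ε , r)
    ι-realises r p = Kθ-resp {θ r p ⁻¹ , r}
      (sym (trans (∙-cong (act-inv-1w _) (act-inv-1w _)) (identityʳ _)) , ~-sym (inv1w·r~r r))
      (p , inverseˡ (θ r p))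

    open GroupMorphisms (Group.rawGroup N) (Group.rawGroup G/K)

    -- ι is injective: ι x ≡ ι y modulo K_θ means x⁻¹ y θ(1) = 1, and θ(1) = 1
    ι-mono : IsGroupMonomorphism ι
    ι-mono = record
      { isGroupHomomorphism = record
        { isMonoidHomomorphism = record
          { isMagmaHomomorphism = record
            { isRelHomomorphism = record { cong = λ e → ≈⇒≈K (e , ~-refl) }
            ; homo = λ x y → ≈⇒≈K (∙-congˡ (sym (act-1 y)) , ~-sym (·-idˡ 1w)) }
          ; ε-homo = E.refl }
        ; ⁻¹-homo = λ x → ≈⇒≈K (sym (act-inv-1w _) , ~-sym F.ε⁻¹≈ε) }
      ; injective = λ {x} {y} (p , e) → ⁻¹-injective (inverseˡ-unique (x ⁻¹) y (begin
          x ⁻¹ ∙ y                                               ≈⟨ identityʳ _ ⟨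
          (x ⁻¹ ∙ y) ∙ ε
            ≈⟨ ∙-cong (∙-cong (act-inv-1w _) (act-inv-1w _)) (θ-trivial adm p (inv-ˡ 1w)) ⟨
          (act (inv 1w) (x ⁻¹) ∙ act (inv 1w) y) ∙ θ (inv 1w · 1w) p ≈⟨ e ⟩
          ε                                                      ∎)) }

    -- an element (m , w) lies over 1 ∈ F/R iff w ∈ R, and then it is
    -- congruent to ι(m θ(w))
    kernel⊆image : ∀ x → π x ≡R 1w → ∃[ n ] (ι n E.≈ x)
    kernel⊆image (m , w) w≡1 = n , Kθ-resp
        (sym (trans (∙-cong (act-inv-1w _) (act-inv-1w _)) refl) , ~-sym (inv1w·r~r w))
        (w∈R , trans (assoc _ _ _) (inverseˡ n))
      where
      w∈R : R w
      w∈R = R-resp (~-trans (inv-cong (·-idʳ (inv w))) (F.⁻¹-involutive w)) (R-inv w≡1)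
      n = m ∙ θ w w∈R

    -- G/K_θ is an extension of N by F/R inducing the prescribed action: the
    -- lift of w is (1 , w), which conjugates (n , 1) to (w(n) , 1)
    isExtension : IsExtension N RR A G/K ι π lift
    isExtension = record
      { ι-mono     = ι-mono
      ; π-cong     = proj₁
      ; π-hom      = λ x y → ~⇒≡R ~-refl
      ; π-surj     = λ w → (ε , w) , ~⇒≡R ~-refl
      ; exact      = λ x → mk⇔ (kernel⊆image x) (λ (n , ιn≈x) → ≡R-sym (proj₁ ιn≈x))
      ; lift-ok    = λ i → ~⇒≡R ~-refl
      ; prescribed = λ w n → E.trans
          (E.∙-cong (E.∙-cong (eval-lift w) E.refl) (E.⁻¹-cong (eval-lift w)))
          (≈⇒≈K ( trans (∙-cong (identityˡ _) (trans (act-congʳ _ (trans (act-congʳ _ ε⁻¹≈ε) (act-ε _))) (act-ε _)))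
                        (identityʳ _)
                , ~-trans (·-cong (·-idʳ w) ~-refl) (inv-ʳ w)))
      }

    realises : InX N RR A θ
    realises = G/K , ι , π , lift , isExtension , λ r p → E.trans (ι-realises r p) (E.sym (eval-lift r))

  admissible⇒inX : ∀ {θ} → Admissible θ → InX N RR A θ
  admissible⇒inX {θ} adm = Realisation.realises θ adm

mainTheorem17 : ∀ {c ℓ} (N : Group c ℓ) (RR : NormalSubgroup) (A : FAction N) →
    (∀ φ (α : HomF N RR A) → InX N RR A φ → InX N RR A (_⋆_ N RR A φ (HomF.α α)))
    × (∀ φ → _≈R_ N RR A (_⋆_ N RR A φ (1R N RR A)) φ)
    × (∀ φ (α β : HomF N RR A) →
         _≈R_ N RR A (_⋆_ N RR A (_⋆_ N RR A φ (HomF.α α)) (HomF.α β))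
                     (_⋆_ N RR A φ (_⋆_ N RR A (HomF.α α) (HomF.α β))))
    × (∀ φ (α : HomF N RR A) → InX N RR A φ →
         _≈R_ N RR A (_⋆_ N RR A φ (HomF.α α)) φ → _≈R_ N RR A (HomF.α α) (1R N RR A))
    × (∀ φ ψ → InX N RR A φ → InX N RR A ψ →
         Σ[ α ∈ HomF N RR A ] _≈R_ N RR A ψ (_⋆_ N RR A φ (HomF.α α)))
mainTheorem17 N RR A =
  -- well defined: X is the set of admissible maps, which twisting preserves
    (λ φ α φ∈X → admissible⇒inX (twist-admissible α (inX⇒admissible φ∈X)))
  , (λ φ r p → identityʳ _)
  , (λ φ α β r p → assoc _ _ _)
  -- free: φ(r) α(r) = φ(r) forces α(r) = 1
  , (λ φ α φ∈X fixed r p → identityʳ-unique _ _ (fixed r p))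
  -- transitive: ψ = φ ⋆ (φ⁻¹ψ) with φ⁻¹ψ ∈ Hom_F(R, C)
  , (λ φ ψ φ∈X ψ∈X → difference (inX⇒admissible φ∈X) (inX⇒admissible ψ∈X)
                    , λ r p → sym (\\-leftDividesˡ _ _))
  where
  open Extensions N RR A
  open GroupFacts N
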